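{- Let $G$ be a graph, $R$ a connected subset of $V(G)$, $v_0\in V(G)$, and $P$ a shortest path from $v_0$ to $R$. Then the number of milestones of $P$ is at most $|R|^2+1$.
   Context: Graphs are unweighted and undirected; $R$ is connected if $G[R]$ is connected. $\mathrm{dist}(u,v)$ is the minimum number of edges of a $u$–$v$ path, $\mathrm{dist}(v,R)=\min_{y\in R}\mathrm{dist}(v,y)$. A shortest path from $v_0$ to $R$ is a path from $v_0$ to a vertex of $R$ of length $\mathrm{dist}(v_0,R)$; it contains exactly one vertex $x$ of $R$. Order $V(P)$ by $v\le_P u$ iff $u$ lies on the subpath of $P$ between $v$ and $x$. For $v\in V(G)$ let $\mathrm{prof}(v)\colon R\to\mathbb{Z}$, $\mathrm{prof}(v)(s)=\mathrm{dist}(v,s)-\mathrm{dist}(v,x)$. A vertex $v\in V(P)$ is a milestone of $P$ if $v=x$ or $\mathrm{prof}(v)\neq\mathrm{prof}(u)$ where $u$ is the successor of $v$ in $\le_P$. -}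

module Defs where

open import Data.Nat using (ℕ; zero; suc; _≤_; _+_)
open import Data.Fin using (Fin; inject₁; fromℕ; suc)
open import Data.Fin.Subset using (Subset; _∈_; ∣_∣)
open import Data.Integer using (ℤ; +_; _-_)
open import Data.Product using (Σ; _×_; ∃-syntax)
open import Relation.Binary.PropositionalEquality using (_≡_; _≢_)
open import Relation.Nullary using (¬_)
open import Function.Definitions using (Injective)

record Graph (n : ℕ) : Set₁ where
  field
    Adj   : Fin n → Fin n → Set
    sym   : ∀ {u v} → Adj u v → Adj v u
    irrefl : ∀ {u} → ¬ Adj u u
open Graph public

module _ {n : ℕ} (G : Graph n) where

  data Walk : Fin n → Fin n → ℕ → Set where
    here : ∀ {u} → Walk u u 0
    step : ∀ {u w v k} → Adj G u w → Walk w v k → Walk u v (suc k)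

  data WalkIn (R : Subset n) : Fin n → Fin n → Set where
    here : ∀ {u} → u ∈ R → WalkIn R u u
    step : ∀ {u w v} → u ∈ R → Adj G u w → WalkIn R w v → WalkIn R u v

  Connected : Subset n → Set
  Connected R = ∀ {a b} → a ∈ R → b ∈ R → WalkIn R a b

  IsDist : Fin n → Fin n → ℕ → Set
  IsDist u v d = Walk u v d × (∀ {k} → Walk u v k → d ≤ k)

  IsDistToSet : Fin n → Subset n → ℕ → Set
  IsDistToSet u R d =
    (Σ (Fin n) λ y → y ∈ R × Walk u y d) × (∀ {y k} → y ∈ R → Walk u y k → d ≤ k)

  record IsPath (k : ℕ) (p : Fin (suc k) → Fin n) : Set where
    field
      distinct : Injective _≡_ _≡_ p
      adjacent : ∀ (i : Fin k) → Adj G (p (inject₁ i)) (p (suc i))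

  record IsShortestPathToSet (v₀ : Fin n) (R : Subset n) (k : ℕ)
                             (p : Fin (suc k) → Fin n) : Set where
    field
      path   : IsPath k p
      start  : p Data.Fin.zero ≡ v₀
      endInR : p (fromℕ k) ∈ R
      shortest : IsDistToSet v₀ R k

  -- prof(v) ≠ prof(u) (with respect to R and the end vertex x):
  -- some s ∈ R has dist(v,s)-dist(v,x) ≠ dist(u,s)-dist(u,x).
  ProfDiffers : Subset n → Fin n → Fin n → Fin n → Set
  ProfDiffers R x v u =
    ∃[ s ] (s ∈ R × ∃[ a ] ∃[ b ] ∃[ c ] ∃[ e ]
      (IsDist v s a × IsDist v x b × IsDist u s c × IsDist u x e ×
       ((+ a) - (+ b)) ≢ ((+ c) - (+ e))))

  -- Vertex p i (i an index on the path, ordered towards x = p k) is a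
  -- milestone: it is x, or its profile differs from that of its successor.
  data Milestone (R : Subset n) (k : ℕ) (p : Fin (suc k) → Fin n) :
                 Fin (suc k) → Set where
    isEnd  : Milestone R k p (fromℕ k)
    change : ∀ (i : Fin k) →
             ProfDiffers R (p (fromℕ k)) (p (inject₁ i)) (p (suc i)) →
             Milestone R k p (inject₁ i)

{-# OPTIONS --safe #-}
-- For s ∈ R the quantity prof(v)(s) never decreases as v moves along P towards x
-- (triangle inequality along P), and it stays in [0, |R|): it is nonnegative because P is
-- shortest, and at most dist(x, s) < |R| because R is connected. So every milestone v ≠ x has
-- some s ∈ R where the profile strictly increases at the next vertex, and the pair
-- (s, new value) determines v. With x this gives at most |R| · |R| + 1 milestones.
module Submission where

open import Defs hiding (sym)
open import Data.Nat using (ℕ; suc; _≤_; _<_; _+_; _*_; _∸_; z≤n; s≤s; s≤s⁻¹)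
open import Data.Nat.Properties
  using (≤-antisym; <-trans; <⇒≢; ≤∧≢⇒<; n<1+n; +-comm; +-assoc; +-suc; +-cancelˡ-≡; +-monoʳ-≤; +-monoʳ-<;
         m+[n∸m]≡n; m+n∸m≡n; ∸-monoˡ-<; ∸-cancelʳ-≡; module ≤-Reasoning)
open import Data.Fin as Fin using (Fin; toℕ; inject₁; fromℕ)
open import Data.Fin.Properties using (toℕ-fromℕ; ≤fromℕ; toℕ≤pred[n]; toℕ-inject₁)
  renaming (<-cmp to <-cmpᶠ; _≟_ to _≟ᶠ_)
open import Data.Integer using (+_; _-_)
import Data.Integer.Properties as ℤ
open import Data.Fin.Subset using (Subset; ∣_∣; inside; outside) renaming (_∈_ to _∈ₛ_)
open import Data.Vec using ([]; _∷_)
open import Data.Vec.Base using (here; there)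
open import Data.List using (List; []; _∷_; length; map; _++_; cartesianProduct; upTo)
open import Data.List.Properties using (length-map; length-++; length-removeAt′; length-upTo)
open import Data.List.Relation.Unary.All as All using (All; []; _∷_)
open import Data.List.Relation.Unary.Any using (here; there; index; _─_)
open import Data.List.Relation.Unary.AllPairs using ([]; _∷_)
open import Data.List.Relation.Unary.Unique.Propositional using (Unique)
open import Data.List.Membership.Propositional using (_∈_)
open import Data.List.Membership.Propositional.Properties using (∈-map⁺; ∈-cartesianProduct⁺; ∈-upTo⁺)
open import Data.List.Relation.Unary.All.Properties using (¬Any⇒All¬)
open import Data.List.Relation.Binary.Subset.Propositional using (_⊆_)
open import Data.Empty using (⊥-elim)
open import Data.Product using (Σ; _×_; _,_; proj₁; proj₂)
open import Data.Product.Properties using (,-injectiveˡ; ,-injectiveʳ)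
open import Data.Maybe using (Maybe; just; nothing)
open import Data.Maybe.Properties using (just-injective)
open import Relation.Nullary using (yes; no; contradiction)
open import Relation.Binary using (tri<; tri≈; tri>)
open import Function using (_∘_)
open import Relation.Binary.PropositionalEquality

module _ {A : Set} where

  ∈-─⁺ : ∀ {x y : A} {xs} (x∈xs : x ∈ xs) → x ≢ y → y ∈ xs → y ∈ (xs ─ x∈xs)
  ∈-─⁺ (here refl) x≢y (here refl) = ⊥-elim (x≢y refl)
  ∈-─⁺ (here refl) x≢y (there y∈xs) = y∈xs
  ∈-─⁺ (there x∈xs) x≢y (here refl) = here refl
  ∈-─⁺ (there x∈xs) x≢y (there y∈xs) = there (∈-─⁺ x∈xs x≢y y∈xs)

  unique∧⊆⇒length≤ : ∀ {xs ys : List A} → Unique xs → xs ⊆ ys → length xs ≤ length ys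
  unique∧⊆⇒length≤ {[]} _ _ = z≤n
  unique∧⊆⇒length≤ {x ∷ xs} {ys} (x∉xs ∷ xs!) xs⊆ys =
    subst (suc (length xs) ≤_) (sym (length-removeAt′ ys (index x∈ys)))
      (s≤s (unique∧⊆⇒length≤ xs! (λ y∈xs → ∈-─⁺ x∈ys (All.lookup x∉xs y∈xs) (xs⊆ys (there y∈xs)))))
    where
    x∈ys : x ∈ ys
    x∈ys = xs⊆ys (here refl)

module _ {A B : Set} {P : A → Set} (f : ∀ {x} → P x → B) where

  length-reduce : ∀ {xs} (pxs : All P xs) → length (All.reduce f pxs) ≡ length xs
  length-reduce [] = refl
  length-reduce (px ∷ pxs) = cong suc (length-reduce pxs)

  reduce-⊆ : ∀ {xs ys} → (∀ {x} (px : P x) → f px ∈ ys) → (pxs : All P xs) → All.reduce f pxs ⊆ ys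
  reduce-⊆ f∈ys (px ∷ pxs) (here refl) = f∈ys px
  reduce-⊆ f∈ys (px ∷ pxs) (there y∈) = reduce-⊆ f∈ys pxs y∈

  module _ (f-injective : ∀ {x y} (px : P x) (py : P y) → f px ≡ f py → x ≡ y) where

    reduce-≢ : ∀ {x xs} (px : P x) (pxs : All P xs) → All (x ≢_) xs → All (f px ≢_) (All.reduce f pxs)
    reduce-≢ px [] [] = []
    reduce-≢ px (py ∷ pys) (x≢y ∷ x≢ys) = (x≢y ∘ f-injective px py) ∷ reduce-≢ px pys x≢ys

    reduce-unique : ∀ {xs} (pxs : All P xs) → Unique xs → Unique (All.reduce f pxs)
    reduce-unique [] [] = []
    reduce-unique (px ∷ pxs) (x∉xs ∷ xs!) = reduce-≢ px pxs x∉xs ∷ reduce-unique pxs xs!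

    unique∧injective⇒length≤ : ∀ {xs ys} → (∀ {x} (px : P x) → f px ∈ ys) →
                               Unique xs → All P xs → length xs ≤ length ys
    unique∧injective⇒length≤ f∈ys xs! pxs =
      subst (_≤ _) (length-reduce pxs) (unique∧⊆⇒length≤ (reduce-unique pxs xs!) (reduce-⊆ f∈ys pxs))

length-cartesianProduct : ∀ {A B : Set} (xs : List A) (ys : List B) →
                          length (cartesianProduct xs ys) ≡ length xs * length ys
length-cartesianProduct [] ys = refl
length-cartesianProduct (x ∷ xs) ys = begin
  length (map (x ,_) ys ++ cartesianProduct xs ys)
    ≡⟨ length-++ (map (x ,_) ys) ⟩
  length (map (x ,_) ys) + length (cartesianProduct xs ys)
    ≡⟨ cong₂ _+_ (length-map (x ,_) ys) (length-cartesianProduct xs ys) ⟩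
  length ys + length xs * length ys
    ∎
  where open ≡-Reasoning

elements : ∀ {n} → Subset n → List (Fin n)
elements [] = []
elements (inside ∷ R) = Fin.zero ∷ map Fin.suc (elements R)
elements (outside ∷ R) = map Fin.suc (elements R)

length-elements : ∀ {n} (R : Subset n) → length (elements R) ≡ ∣ R ∣
length-elements [] = refl
length-elements (inside ∷ R) = cong suc (trans (length-map Fin.suc (elements R)) (length-elements R))
length-elements (outside ∷ R) = trans (length-map Fin.suc (elements R)) (length-elements R)

∈-elements⁺ : ∀ {n} {x : Fin n} {R : Subset n} → x ∈ₛ R → x ∈ elements R
∈-elements⁺ {x = Fin.zero} {inside ∷ R} here = here refl
∈-elements⁺ {x = Fin.suc x} {inside ∷ R} (there x∈R) = there (∈-map⁺ Fin.suc (∈-elements⁺ x∈R))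
∈-elements⁺ {x = Fin.suc x} {outside ∷ R} (there x∈R) = ∈-map⁺ Fin.suc (∈-elements⁺ x∈R)

module _ {n : ℕ} {G : Graph n} where

  infixr 5 _++ʷ_
  _++ʷ_ : ∀ {u v w a b} → Walk G u v a → Walk G v w b → Walk G u w (a + b)
  here ++ʷ w = w
  step e w₁ ++ʷ w₂ = step e (w₁ ++ʷ w₂)

  vertices : ∀ {u v k} → Walk G u v k → List (Fin n)
  vertices {u} here = u ∷ []
  vertices {u} (step _ w) = u ∷ vertices w

  length-vertices : ∀ {u v k} (w : Walk G u v k) → length (vertices w) ≡ suc k
  length-vertices here = refl
  length-vertices (step _ w) = cong suc (length-vertices w)

  walk-along : ∀ {k} {p : Fin (suc k) → Fin n} → (∀ i → Adj G (p (inject₁ i)) (p (Fin.suc i))) →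
               ∀ {i j} → i Fin.≤ j → Walk G (p i) (p j) (toℕ j ∸ toℕ i)
  walk-along adj {Fin.zero} {Fin.zero} _ = here
  walk-along {suc _} adj {Fin.zero} {Fin.suc j} _ =
    step (adj Fin.zero) (walk-along (adj ∘ Fin.suc) {Fin.zero} {j} z≤n)
  walk-along {suc _} adj {Fin.suc i} {Fin.suc j} (s≤s i≤j) = walk-along (adj ∘ Fin.suc) i≤j

module _ {n : ℕ} (G : Graph n) (R : Subset n) where

  open import Data.List.Membership.DecPropositional (_≟ᶠ_ {n}) using (_∈?_)

  record SimpleWalkIn (u v : Fin n) : Set where
    field
      {len}  : ℕ
      walk   : Walk G u v len
      unique : Unique (vertices walk)
      inR    : All (_∈ₛ R) (vertices walk)

  suffix-from : ∀ {t u v k} (w : Walk G u v k) → Unique (vertices w) → All (_∈ₛ R) (vertices w) →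
                t ∈ vertices w → SimpleWalkIn t v
  suffix-from w@here w! w⊆R (here refl) = record { walk = w ; unique = w! ; inR = w⊆R }
  suffix-from w@(step _ _) w! w⊆R (here refl) = record { walk = w ; unique = w! ; inR = w⊆R }
  suffix-from (step _ w) (_ ∷ w!) (_ ∷ w⊆R) (there t∈w) = suffix-from w w! w⊆R t∈w

  simplify : ∀ {u v} → WalkIn G R u v → SimpleWalkIn u v
  simplify (here u∈R) = record { walk = here ; unique = [] ∷ [] ; inR = u∈R ∷ [] }
  simplify (step {u} u∈R e W) with simplify W
  ... | record { walk = w ; unique = w! ; inR = w⊆R } with u ∈? vertices w
  ...   | yes u∈w = suffix-from w w! w⊆R u∈w
  ...   | no u∉w = record { walk = step e w ; unique = ¬Any⇒All¬ _ u∉w ∷ w! ; inR = u∈R ∷ w⊆R }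

  simpleWalk-len<∣R∣ : ∀ {u v} (S : SimpleWalkIn u v) → SimpleWalkIn.len S < ∣ R ∣
  simpleWalk-len<∣R∣ record { walk = w ; unique = w! ; inR = w⊆R } =
    subst₂ _≤_ (length-vertices w) (length-elements R)
      (unique∧⊆⇒length≤ w! (∈-elements⁺ ∘ All.lookup w⊆R))

  connected⇒walk<∣R∣ : Connected G R → ∀ {a b} → a ∈ₛ R → b ∈ₛ R → Σ ℕ λ d → Walk G a b d × d < ∣ R ∣
  connected⇒walk<∣R∣ conn a∈R b∈R = _ , SimpleWalkIn.walk S , simpleWalk-len<∣R∣ S
    where
    S : SimpleWalkIn _ _
    S = simplify (conn a∈R b∈R)

codes : ∀ {n} → Subset n → List (Maybe (Fin n × ℕ))
codes R = nothing ∷ map just (cartesianProduct (elements R) (upTo ∣ R ∣))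

length-codes : ∀ {n} (R : Subset n) → length (codes R) ≡ ∣ R ∣ * ∣ R ∣ + 1
length-codes R = begin
  suc (length (map just pairs))
    ≡⟨ cong suc (length-map just pairs) ⟩
  suc (length pairs)
    ≡⟨ cong suc (length-cartesianProduct (elements R) (upTo ∣ R ∣)) ⟩
  suc (length (elements R) * length (upTo ∣ R ∣))
    ≡⟨ cong₂ (λ a b → suc (a * b)) (length-elements R) (length-upTo ∣ R ∣) ⟩
  suc (∣ R ∣ * ∣ R ∣)
    ≡⟨ +-comm 1 (∣ R ∣ * ∣ R ∣) ⟩
  ∣ R ∣ * ∣ R ∣ + 1
    ∎
  where
  open ≡-Reasoning
  pairs : List (Fin _ × ℕ)
  pairs = cartesianProduct (elements R) (upTo ∣ R ∣)

+[1+m]-+[1+n]≡+m-+n : ∀ m n → + suc m - + suc n ≡ + m - + n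
+[1+m]-+[1+n]≡+m-+n m n = trans (ℤ.[1+m]⊖[1+n]≡m⊖n m n) (sym (ℤ.m-n≡m⊖n m n))

module ShortestPathProfile
  {n} {G : Graph n} {R : Subset n} {v₀ : Fin n} {k : ℕ} {p : Fin (suc k) → Fin n}
  (sp : IsShortestPathToSet G v₀ R k p) where

  open IsShortestPathToSet sp
  open IsPath path using (adjacent)

  x : Fin n
  x = p (fromℕ k)

  from-start : ∀ j → Walk G v₀ (p j) (toℕ j)
  from-start j = subst (λ u → Walk G u (p j) (toℕ j)) start (walk-along adjacent {Fin.zero} {j} z≤n)

  to-end : ∀ j → Walk G (p j) x (k ∸ toℕ j)
  to-end j = subst (λ d → Walk G (p j) x (d ∸ toℕ j)) (toℕ-fromℕ k) (walk-along adjacent (≤fromℕ j))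

  -- For s ∈ R, toℕ j + dist(p j, s) = prof(p j)(s) + k, since dist(p j, x) = k - toℕ j.
  k≤toℕ+walk : ∀ j {s t} → s ∈ₛ R → Walk G (p j) s t → k ≤ toℕ j + t
  k≤toℕ+walk j s∈R w = proj₂ shortest s∈R (from-start j ++ʷ w)

  toℕ+dist-end≡k : ∀ j {b} → IsDist G (p j) x b → toℕ j + b ≡ k
  toℕ+dist-end≡k j {b} (w , minimal) = ≤-antisym toℕ+b≤k (k≤toℕ+walk j endInR w)
    where
    toℕ+b≤k : toℕ j + b ≤ k
    toℕ+b≤k = begin
      toℕ j + b             ≤⟨ +-monoʳ-≤ (toℕ j) (minimal (to-end j)) ⟩
      toℕ j + (k ∸ toℕ j)   ≡⟨ m+[n∸m]≡n (toℕ≤pred[n] j) ⟩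
      k                     ∎
      where open ≤-Reasoning

  toℕ+dist-mono : ∀ {i j s a t} → i Fin.≤ j → IsDist G (p i) s a → Walk G (p j) s t →
                  toℕ i + a ≤ toℕ j + t
  toℕ+dist-mono {i} {j} {a = a} {t} i≤j (_ , minimal) w = begin
    toℕ i + a                       ≤⟨ +-monoʳ-≤ (toℕ i) (minimal (walk-along adjacent i≤j ++ʷ w)) ⟩
    toℕ i + ((toℕ j ∸ toℕ i) + t)   ≡⟨ +-assoc (toℕ i) _ t ⟨
    toℕ i + (toℕ j ∸ toℕ i) + t     ≡⟨ cong (_+ t) (m+[n∸m]≡n i≤j) ⟩
    toℕ j + t                       ∎
    where open ≤-Reasoning

  toℕ+dist<k+∣R∣ : Connected G R → ∀ j {s a} → s ∈ₛ R → IsDist G (p j) s a → toℕ j + a < k + ∣ R ∣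
  toℕ+dist<k+∣R∣ conn j {a = a} s∈R dist with connected⇒walk<∣R∣ G R conn endInR s∈R
  ... | d , w , d<∣R∣ = begin-strict
    toℕ j + a            ≤⟨ toℕ+dist-mono (≤fromℕ j) dist w ⟩
    toℕ (fromℕ k) + d    ≡⟨ cong (_+ d) (toℕ-fromℕ k) ⟩
    k + d                <⟨ +-monoʳ-< k d<∣R∣ ⟩
    k + ∣ R ∣            ∎
    where open ≤-Reasoning

  -- before ≤ after says prof(p i)(s) < prof(p (i + 1))(s).
  record ProfileRise (i : Fin k) : Set where
    field
      s             : Fin n
      s∈R           : s ∈ₛ R
      {before after} : ℕ
      dist-before   : IsDist G (p (inject₁ i)) s before
      dist-after    : IsDist G (p (Fin.suc i)) s after
      before≤after  : before ≤ after
  open ProfileRise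

  profDiffers⇒rise : ∀ i → ProfDiffers G R x (p (inject₁ i)) (p (Fin.suc i)) → ProfileRise i
  profDiffers⇒rise i (s , s∈R , a , b , c , e , dist-a , dist-b , dist-c , dist-e , a-b≢c-e) =
    record { s = s ; s∈R = s∈R ; dist-before = dist-a ; dist-after = dist-c
           ; before≤after = s≤s⁻¹ (≤∧≢⇒< a≤1+c a≢1+c) }
    where
    b≡1+e : b ≡ suc e
    b≡1+e = +-cancelˡ-≡ (toℕ i) b (suc e) (begin
      toℕ i + b             ≡⟨ cong (_+ b) (toℕ-inject₁ i) ⟨
      toℕ (inject₁ i) + b   ≡⟨ toℕ+dist-end≡k (inject₁ i) dist-b ⟩
      k                     ≡⟨ toℕ+dist-end≡k (Fin.suc i) dist-e ⟨
      suc (toℕ i) + e       ≡⟨ +-suc (toℕ i) e ⟨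
      toℕ i + suc e         ∎)
      where open ≡-Reasoning
    a≤1+c : a ≤ suc c
    a≤1+c = proj₂ dist-a (step (adjacent i) (proj₁ dist-c))
    a≢1+c : a ≢ suc c
    a≢1+c refl =
      a-b≢c-e (subst (λ b → + suc c - + b ≡ + c - + e) (sym b≡1+e) (+[1+m]-+[1+n]≡+m-+n c e))

  height : ∀ {i} → ProfileRise i → ℕ
  height {i} ρ = toℕ i + after ρ

  k≤height : ∀ {i} (ρ : ProfileRise i) → k ≤ height ρ
  k≤height {i} ρ = begin
    k                             ≤⟨ k≤toℕ+walk (inject₁ i) (s∈R ρ) (proj₁ (dist-before ρ)) ⟩
    toℕ (inject₁ i) + before ρ    ≡⟨ cong (_+ before ρ) (toℕ-inject₁ i) ⟩
    toℕ i + before ρ              ≤⟨ +-monoʳ-≤ (toℕ i) (before≤after ρ) ⟩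
    toℕ i + after ρ               ∎
    where open ≤-Reasoning

  height∸k<∣R∣ : Connected G R → ∀ {i} (ρ : ProfileRise i) → height ρ ∸ k < ∣ R ∣
  height∸k<∣R∣ conn {i} ρ = subst (height ρ ∸ k <_) (m+n∸m≡n k ∣ R ∣)
    (∸-monoˡ-< height<k+∣R∣ (k≤height ρ))
    where
    height<k+∣R∣ : height ρ < k + ∣ R ∣
    height<k+∣R∣ = <-trans (n<1+n (height ρ)) (toℕ+dist<k+∣R∣ conn (Fin.suc i) (s∈R ρ) (dist-after ρ))

  height-increasing : ∀ {i i′} (ρ : ProfileRise i) (ρ′ : ProfileRise i′) → i Fin.< i′ → s ρ ≡ s ρ′ →
                      height ρ < height ρ′
  height-increasing {i} {i′} ρ ρ′ i<i′ s≡s′ = begin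
    suc (toℕ i) + after ρ            ≤⟨ toℕ+dist-mono 1+i≤i′ (dist-after ρ) walk-before′ ⟩
    toℕ (inject₁ i′) + before ρ′     ≡⟨ cong (_+ before ρ′) (toℕ-inject₁ i′) ⟩
    toℕ i′ + before ρ′               ≤⟨ +-monoʳ-≤ (toℕ i′) (before≤after ρ′) ⟩
    toℕ i′ + after ρ′                ∎
    where
    open ≤-Reasoning
    1+i≤i′ : Fin.suc i Fin.≤ inject₁ i′
    1+i≤i′ = subst (suc (toℕ i) ≤_) (sym (toℕ-inject₁ i′)) i<i′
    walk-before′ : Walk G (p (inject₁ i′)) (s ρ) (before ρ′)
    walk-before′ = subst (λ t → Walk G _ t _) (sym s≡s′) (proj₁ (dist-before ρ′))

  height-injective : ∀ {i i′} (ρ : ProfileRise i) (ρ′ : ProfileRise i′) →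
                     s ρ ≡ s ρ′ → height ρ ≡ height ρ′ → i ≡ i′
  height-injective {i} {i′} ρ ρ′ s≡s′ h≡h′ with <-cmpᶠ i i′
  ... | tri< i<i′ _ _ = contradiction h≡h′ (<⇒≢ (height-increasing ρ ρ′ i<i′ s≡s′))
  ... | tri≈ _ i≡i′ _ = i≡i′
  ... | tri> _ _ i′<i = contradiction (sym h≡h′) (<⇒≢ (height-increasing ρ′ ρ i′<i (sym s≡s′)))

  -- For i < k the code is (s, prof(p (i + 1))(s) - 1), which lies in R × [0, |R|).
  code : ∀ {j} → Milestone G R k p j → Maybe (Fin n × ℕ)
  code isEnd = nothing
  code (change i differs) = just (s ρ , height ρ ∸ k)
    where
    ρ : ProfileRise i
    ρ = profDiffers⇒rise i differs

  code-injective : ∀ {j j′} (m : Milestone G R k p j) (m′ : Milestone G R k p j′) →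
                   code m ≡ code m′ → j ≡ j′
  code-injective isEnd isEnd _ = refl
  code-injective (change i differs) (change i′ differs′) code≡ =
    cong inject₁ (height-injective ρ ρ′ (,-injectiveˡ pair≡)
                   (∸-cancelʳ-≡ (k≤height ρ) (k≤height ρ′) (,-injectiveʳ pair≡)))
    where
    ρ : ProfileRise i
    ρ = profDiffers⇒rise i differs
    ρ′ : ProfileRise i′
    ρ′ = profDiffers⇒rise i′ differs′
    pair≡ : (s ρ , height ρ ∸ k) ≡ (s ρ′ , height ρ′ ∸ k)
    pair≡ = just-injective code≡

  code∈codes : Connected G R → ∀ {j} (m : Milestone G R k p j) → code m ∈ codes R
  code∈codes conn isEnd = here refl
  code∈codes conn (change i differs) =
    there (∈-map⁺ just (∈-cartesianProduct⁺ (∈-elements⁺ (s∈R ρ)) (∈-upTo⁺ (height∸k<∣R∣ conn ρ))))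
    where
    ρ : ProfileRise i
    ρ = profDiffers⇒rise i differs

lemma3p2 : ∀ {n : ℕ} (G : Graph n) (R : Subset n) → Connected G R →
    ∀ (v₀ : Fin n) (k : ℕ) (p : Fin (suc k) → Fin n) →
    IsShortestPathToSet G v₀ R k p →
    ∀ (ms : List (Fin (suc k))) → Unique ms → All (Milestone G R k p) ms →
    length ms ≤ ∣ R ∣ * ∣ R ∣ + 1
lemma3p2 G R conn v₀ k p sp ms ms! milestones =
  subst (length ms ≤_) (length-codes R)
    (unique∧injective⇒length≤ code code-injective (code∈codes conn) ms! milestones)
  where open ShortestPathProfile sp
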